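{- Let $i,j$ be two vertices of the $d$-dimensional hypercube whose Hamming distance satisfies $\operatorname{dist}(i,j)\ge d/2$. Then $t\mapsto (P^t)_{i,j}$ is monotone increasing (non-decreasing) in $t\in\mathbb{N}$.
   Context: The $d$-dimensional hypercube has vertex set $\{0,1\}^d$, vertices adjacent iff they differ in exactly one bit; $\operatorname{dist}$ is the graph (Hamming) distance. Its diffusion matrix is $P_{i,j}=1/(2d)$ if $i,j$ are adjacent, $P_{i,i}=1/2$, and $0$ otherwise. -}

module Defs where

open import Data.Bool using (Bool; true; false; if_then_else_)
open import Data.Nat using (ℕ; zero; suc) renaming (_*_ to _*ℕ_)
open import Data.Nat.Properties using (_≟_)
open import Data.Integer using (+_)
open import Data.Rational using (ℚ; 0ℚ; 1ℚ; _/_; _+_; _*_)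
open import Data.Vec using (Vec; []; _∷_)
open import Data.List using (List; []; _∷_; map; _++_; foldr)
open import Relation.Nullary using (yes; no)

Vertex : ℕ → Set
Vertex d = Vec Bool d

dist : ∀ {d} → Vertex d → Vertex d → ℕ
dist [] [] = 0
dist (true ∷ x) (true ∷ y) = dist x y
dist (false ∷ x) (false ∷ y) = dist x y
dist (true ∷ x) (false ∷ y) = suc (dist x y)
dist (false ∷ x) (true ∷ y) = suc (dist x y)

allVertices : (d : ℕ) → List (Vertex d)
allVertices zero = [] ∷ []
allVertices (suc d) = map (true ∷_) (allVertices d) ++ map (false ∷_) (allVertices d)

sumℚ : List ℚ → ℚ
sumℚ = foldr _+_ 0ℚ

-- 1/(2d)  (the value for d = 0 is irrelevant: the theorem assumes d ≥ 1)
inv2d : ℕ → ℚ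
inv2d zero = 0ℚ
inv2d (suc n) = + 1 / (2 *ℕ suc n)

P : (d : ℕ) → Vertex d → Vertex d → ℚ
P d i j with dist i j
... | 0 = + 1 / 2
... | 1 = inv2d d
... | suc (suc _) = 0ℚ

Ppow : (d : ℕ) → ℕ → Vertex d → Vertex d → ℚ
Ppow d zero i j with dist i j
... | 0 = 1ℚ
... | suc _ = 0ℚ
Ppow d (suc t) i j = sumℚ (map (λ k → Ppow d t i k * P d k j) (allVertices d))

module Submission where

-- By symmetry (Pᵗ)ᵢⱼ = Yₜ(w) depends only on w = dist(i,j), and summing over the
-- cube coordinate by coordinate yields the recurrence
--   Yₜ₊₁(w) = ½·Yₜ(w) + (w·Yₜ(w-1) + (d-w)·Yₜ(w+1)) / 2d.
-- Clearing denominators, Zₜ(w) = (2d)ᵗ·Yₜ(w) is a natural number with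
--   Zₜ₊₁(w) = d·Zₜ(w) + w·Zₜ(w-1) + (d-w)·Zₜ(w+1),
-- and the theorem amounts to Zₜ₊₁(w) ≥ 2d·Zₜ(w).  To prove this, let
-- (T f)(m) = 2m·f(m) + (d-m)·f(m+1).  The falling factorials m⁽ʷ⁾ satisfy a matching
-- three-term recurrence under T, whence (Tᵗ m⁽ʷ⁾)(0) = d⁽ʷ⁾·Zₜ(w).  When d ≤ 2w the
-- function m ↦ m⁽ʷ⁾ at least doubles at every step inside 0 … d, T preserves this,
-- and comparing the values at m = 0 and m = 1 gives the inequality.

module FallingFactorialWalk where

  open import Data.Nat
  open import Data.Nat.Properties
  open import Data.Nat.Combinatorics.Base using (_P′_)
  open import Data.Nat.Combinatorics.Specification using (nP′k≡n[n∸1P′k∸1])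
  open import Data.Sum using (inj₁; inj₂)
  open import Relation.Nullary using (yes; no)
  open import Relation.Binary.PropositionalEquality
  open import Data.Nat.Solver using (module +-*-Solver)
  open +-*-Solver

  falling : ℕ → ℕ → ℕ
  falling w m = m P′ w

  falling-vanish : ∀ {w m} → m < w → falling w m ≡ 0
  falling-vanish {suc v} {m} (s≤s m≤v) = cong (_* falling v m) (m≤n⇒m∸n≡0 m≤v)

  falling-pos : ∀ {w m} → w ≤ m → 0 < falling w m
  falling-pos {zero} _ = z<s
  falling-pos {suc v} v<m = *-mono-< (m<n⇒0<n∸m v<m) (falling-pos (<⇒≤ v<m))

  -- m · m⁽ʷ⁾ = w · m⁽ʷ⁾ + m⁽ʷ⁺¹⁾, since m⁽ʷ⁺¹⁾ = (m - w) · m⁽ʷ⁾.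
  falling-absorb : ∀ w m → m * falling w m ≡ w * falling w m + falling (suc w) m
  falling-absorb w m with w ≤? m
  ... | yes w≤m = begin
    m * falling w m                          ≡⟨ cong (_* falling w m) (sym (m+[n∸m]≡n w≤m)) ⟩
    (w + (m ∸ w)) * falling w m              ≡⟨ *-distribʳ-+ (falling w m) w (m ∸ w) ⟩
    w * falling w m + falling (suc w) m      ∎
    where open ≡-Reasoning
  ... | no w≰m rewrite falling-vanish (≰⇒> w≰m) =
    trans (*-zeroʳ m) (sym (trans (cong (_+ (m ∸ w) * 0) (*-zeroʳ w)) (*-zeroʳ (m ∸ w))))

  falling-pascal : ∀ w m → falling w (suc m) ≡ falling w m + w * falling (w ∸ 1) m
  falling-pascal zero m = refl
  falling-pascal (suc v) m = begin
    falling (suc v) (suc m)                  ≡⟨ nP′k≡n[n∸1P′k∸1] (suc m) (suc v) ⟩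
    suc m * g                                ≡⟨ cong (g +_) (falling-absorb v m) ⟩
    g + (v * g + falling (suc v) m)          ≡⟨ solve 3 (λ g vg f → g :+ (vg :+ f) := f :+ (g :+ vg)) refl g (v * g) (falling (suc v) m) ⟩
    falling (suc v) m + suc v * g            ∎
    where
    open ≡-Reasoning
    g = falling v m

  module Walk (d : ℕ) where

    walk : (ℕ → ℕ) → ℕ → ℕ
    walk f m = 2 * m * f m + (d ∸ m) * f (suc m)

    _≈_ : (ℕ → ℕ) → (ℕ → ℕ) → Set
    f ≈ g = ∀ m → m ≤ d → f m ≡ g m

    -- T only looks at f on 0 … d, since the coefficient of f(d+1) is d - d = 0.
    walk-cong : ∀ {f g} → f ≈ g → walk f ≈ walk g
    walk-cong {f} {g} f≈g m m≤d with m≤n⇒m<n∨m≡n m≤d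
    ... | inj₁ m<d = cong₂ (λ x y → 2 * m * x + (d ∸ m) * y) (f≈g m m≤d) (f≈g (suc m) m<d)
    ... | inj₂ refl rewrite n∸n≡0 m = cong (λ x → 2 * m * x + 0) (f≈g m m≤d)

    walk-linear : ∀ x y f g h m →
      walk (λ n → x * f n + y * g n + h n) m ≡ x * walk f m + y * walk g m + walk h m
    walk-linear x y f g h m =
      solve 10 (λ m x y dm f g h f' g' h' →
          con 2 :* m :* (x :* f :+ y :* g :+ h) :+ dm :* (x :* f' :+ y :* g' :+ h')
       := x :* (con 2 :* m :* f :+ dm :* f') :+ y :* (con 2 :* m :* g :+ dm :* g') :+ (con 2 :* m :* h :+ dm :* h'))
       refl m x y (d ∸ m) (f m) (g m) (h m) (f (suc m)) (g (suc m)) (h (suc m))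

    a : ℕ → ℕ
    a w = w * (suc d ∸ w)

    ∸-telescope : ∀ {v m} → v ≤ m → m ≤ d → (m ∸ v) + (d ∸ m) ≡ d ∸ v
    ∸-telescope {v} {m} v≤m m≤d = begin
      (m ∸ v) + (d ∸ m)       ≡⟨ +-comm (m ∸ v) (d ∸ m) ⟩
      (d ∸ m) + (m ∸ v)       ≡⟨ sym (+-∸-assoc (d ∸ m) v≤m) ⟩
      ((d ∸ m) + m) ∸ v       ≡⟨ cong (_∸ v) (m∸n+n≡m m≤d) ⟩
      d ∸ v                   ∎
      where open ≡-Reasoning

    weighted-telescope : ∀ w m → m ≤ d →
      w * falling w m + (d ∸ m) * (w * falling (w ∸ 1) m) ≡ a w * falling (w ∸ 1) m
    weighted-telescope zero m _ = *-zeroʳ (d ∸ m)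
    weighted-telescope (suc v) m m≤d with v ≤? m
    ... | yes v≤m = begin
      suc v * ((m ∸ v) * g) + (d ∸ m) * (suc v * g)  ≡⟨ solve 4 (λ s x y g → s :* (x :* g) :+ y :* (s :* g) := s :* (x :+ y) :* g) refl (suc v) (m ∸ v) (d ∸ m) g ⟩
      suc v * ((m ∸ v) + (d ∸ m)) * g                ≡⟨ cong (λ x → suc v * x * g) (∸-telescope v≤m m≤d) ⟩
      suc v * (d ∸ v) * g                            ∎
      where
      open ≡-Reasoning
      g = falling v m
    ... | no v≰m rewrite falling-vanish (≰⇒> v≰m) =
      solve 4 (λ s x y z → s :* (x :* con 0) :+ y :* (s :* con 0) := s :* z :* con 0) refl (suc v) (m ∸ v) (d ∸ m) (d ∸ v)

    recur : (ℕ → ℕ → ℕ) → ℕ → ℕ → ℕ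
    recur h w m = d * h w m + a w * h (w ∸ 1) m + h (suc w) m

    falling-recurrence : ∀ w → walk (falling w) ≈ recur falling w
    falling-recurrence w m m≤d = begin
      2 * m * F + (d ∸ m) * falling w (suc m)        ≡⟨ cong (λ x → 2 * m * F + (d ∸ m) * x) (falling-pascal w m) ⟩
      2 * m * F + (d ∸ m) * (F + w * G)              ≡⟨ solve 4 (λ m dm F wG → con 2 :* m :* F :+ dm :* (F :+ wG) := m :* F :+ (m :+ dm) :* F :+ dm :* wG) refl m (d ∸ m) F (w * G) ⟩
      m * F + (m + (d ∸ m)) * F + (d ∸ m) * (w * G)  ≡⟨ cong₂ (λ x y → x + y * F + (d ∸ m) * (w * G)) (falling-absorb w m) (m+[n∸m]≡n m≤d) ⟩
      (w * F + F′) + d * F + (d ∸ m) * (w * G)       ≡⟨ solve 4 (λ wF F′ dF x → wF :+ F′ :+ dF :+ x := dF :+ (wF :+ x) :+ F′) refl (w * F) F′ (d * F) ((d ∸ m) * (w * G)) ⟩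
      d * F + (w * F + (d ∸ m) * (w * G)) + F′       ≡⟨ cong (λ x → d * F + x + F′) (weighted-telescope w m m≤d) ⟩
      d * F + a w * G + F′                           ∎
      where
      open ≡-Reasoning
      F = falling w m
      G = falling (w ∸ 1) m
      F′ = falling (suc w) m

    walked : ℕ → ℕ → ℕ → ℕ
    walked zero w = falling w
    walked (suc t) w = walk (walked t w)

    -- Since T is linear and commutes with its own powers, the recurrence
    -- propagates to all iterates: Tᵗ⁺¹ m⁽ʷ⁾ = d·Tᵗm⁽ʷ⁾ + w(d+1-w)·Tᵗm⁽ʷ⁻¹⁾ + Tᵗm⁽ʷ⁺¹⁾.
    walked-recurrence : ∀ t w → walked (suc t) w ≈ recur (walked t) w
    walked-recurrence zero w = falling-recurrence w
    walked-recurrence (suc t) w m m≤d = begin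
      walk (walked (suc t) w) m                              ≡⟨ walk-cong (walked-recurrence t w) m m≤d ⟩
      walk (recur (walked t) w) m                            ≡⟨ walk-linear d (a w) (walked t w) (walked t (w ∸ 1)) (walked t (suc w)) m ⟩
      recur (walked (suc t)) w m                             ∎
      where open ≡-Reasoning

    Doubling : (ℕ → ℕ) → Set
    Doubling f = ∀ m → suc m ≤ d → 2 * f m ≤ f (suc m)

    -- Doubling, weighted by d - m (which vanishes outside the range).
    doubling-weighted : ∀ {f} → Doubling f → ∀ m → (d ∸ m) * (2 * f m) ≤ (d ∸ m) * f (suc m)
    doubling-weighted {f} doubling m with suc m ≤? d
    ... | yes m<d = *-monoʳ-≤ (d ∸ m) (doubling m m<d)
    ... | no m≮d rewrite m≤n⇒m∸n≡0 (≮⇒≥ m≮d) = ≤-refl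

    -- If d ≤ 2w then m ↦ m⁽ʷ⁾ is doubling: (m+1)⁽ʷ⁾/m⁽ʷ⁾ = (m+1)/(m+1-w) ≥ 2.
    falling-doubling : ∀ w → d ≤ 2 * w → Doubling (falling w)
    falling-doubling zero d≤0 m m<d with () ← ≤-trans m<d d≤0
    falling-doubling (suc v) d≤2w m m<d = begin
      2 * F                      ≡⟨ cong (F +_) (+-identityʳ F) ⟩
      F + F                      ≤⟨ +-monoʳ-≤ F (*-monoˡ-≤ g m∸v≤1+v) ⟩
      F + suc v * g              ≡⟨ falling-pascal (suc v) m ⟨
      falling (suc v) (suc m)    ∎
      where
      open ≤-Reasoning
      g = falling v m
      F = falling (suc v) m
      m∸v≤1+v : m ∸ v ≤ suc v
      m∸v≤1+v = ≤-trans (m≤n+o⇒m∸n≤o m v (s≤s⁻¹ (≤-trans m<d d≤2w))) (≤-reflexive (cong suc (+-identityʳ v)))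

    -- T preserves the doubling property:
    -- 2(T f)(m) = 4m f(m) + 2(d-m) f(m+1) ≤ 2(m+1) f(m+1) + 2(d-m-1) f(m+1) ≤ (T f)(m+1).
    walk-doubling : ∀ {f} → Doubling f → Doubling (walk f)
    walk-doubling {f} doubling m m<d = begin
      2 * (2 * m * f₀ + (d ∸ m) * f₁)        ≡⟨ cong (λ x → 2 * (2 * m * f₀ + x * f₁)) (+-∸-assoc 1 m<d) ⟩
      2 * (2 * m * f₀ + suc r * f₁)          ≡⟨ solve 4 (λ m r f₀ f₁ → con 2 :* (con 2 :* m :* f₀ :+ (con 1 :+ r) :* f₁) := m :* (con 2 :* (con 2 :* f₀)) :+ con 2 :* (con 1 :+ r) :* f₁) refl m r f₀ f₁ ⟩
      m * (2 * (2 * f₀)) + 2 * suc r * f₁    ≤⟨ +-monoˡ-≤ (2 * suc r * f₁) (*-monoʳ-≤ m (*-monoʳ-≤ 2 (doubling m m<d))) ⟩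
      m * (2 * f₁) + 2 * suc r * f₁          ≡⟨ solve 3 (λ m r f₁ → m :* (con 2 :* f₁) :+ con 2 :* (con 1 :+ r) :* f₁ := con 2 :* (con 1 :+ m) :* f₁ :+ r :* (con 2 :* f₁)) refl m r f₁ ⟩
      2 * suc m * f₁ + r * (2 * f₁)          ≤⟨ +-monoʳ-≤ (2 * suc m * f₁) (doubling-weighted {f} doubling (suc m)) ⟩
      2 * suc m * f₁ + r * f (suc (suc m))   ∎
      where
      open ≤-Reasoning
      r = d ∸ suc m
      f₀ = f m
      f₁ = f (suc m)

    walked-doubling : ∀ w → d ≤ 2 * w → ∀ t → Doubling (walked t w)
    walked-doubling w d≤2w zero = falling-doubling w d≤2w
    walked-doubling w d≤2w (suc t) = walk-doubling (walked-doubling w d≤2w t)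

    -- Zₜ(w): the three-term recurrence of (2d)ᵗ (Pᵗ)ᵢⱼ as a function of w = dist i j.
    walkCount : ℕ → ℕ → ℕ
    walkCount zero zero = 1
    walkCount zero (suc _) = 0
    walkCount (suc t) w = d * walkCount t w + w * walkCount t (w ∸ 1) + (d ∸ w) * walkCount t (suc w)

    falling-weight-at-d : ∀ w → a w * falling (w ∸ 1) d ≡ w * falling w d
    falling-weight-at-d w = begin
      a w * falling (w ∸ 1) d                                     ≡⟨ weighted-telescope w d ≤-refl ⟨
      w * falling w d + (d ∸ d) * (w * falling (w ∸ 1) d)         ≡⟨ cong (λ x → w * falling w d + x * (w * falling (w ∸ 1) d)) (n∸n≡0 d) ⟩
      w * falling w d + 0                                         ≡⟨ +-identityʳ (w * falling w d) ⟩
      w * falling w d                                             ∎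
      where open ≡-Reasoning

    walked-at-0 : ∀ t w → walked t w 0 ≡ falling w d * walkCount t w
    walked-at-0 zero zero = refl
    walked-at-0 zero (suc v) = trans (cong (_* falling v 0) (0∸n≡0 v)) (sym (*-zeroʳ (falling (suc v) d)))
    walked-at-0 (suc t) w = begin
      walked (suc t) w 0                                               ≡⟨ walked-recurrence t w 0 z≤n ⟩
      d * walked t w 0 + a w * walked t (w ∸ 1) 0 + walked t (suc w) 0 ≡⟨ cong₂ _+_ (cong₂ (λ x y → d * x + a w * y) (walked-at-0 t w) (walked-at-0 t (w ∸ 1))) (walked-at-0 t (suc w)) ⟩
      d * (F * Z₀) + a w * (falling (w ∸ 1) d * Z₋) + (d ∸ w) * F * Z₊ ≡⟨ cong (λ x → d * (F * Z₀) + x + (d ∸ w) * F * Z₊) (trans (sym (*-assoc (a w) _ Z₋)) (cong (_* Z₋) (falling-weight-at-d w))) ⟩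
      d * (F * Z₀) + w * F * Z₋ + (d ∸ w) * F * Z₊                     ≡⟨ solve 7 (λ d F Z₀ w Z₋ dw Z₊ → d :* (F :* Z₀) :+ w :* F :* Z₋ :+ dw :* F :* Z₊ := F :* (d :* Z₀ :+ w :* Z₋ :+ dw :* Z₊)) refl d F Z₀ w Z₋ (d ∸ w) Z₊ ⟩
      F * walkCount (suc t) w                                          ∎
      where
      open ≡-Reasoning
      F = falling w d
      Z₀ = walkCount t w
      Z₋ = walkCount t (w ∸ 1)
      Z₊ = walkCount t (suc w)

    -- Indeed d⁽ʷ⁾ Zₜ₊₁(w) = (Tᵗ⁺¹ m⁽ʷ⁾)(0) = d · (Tᵗ m⁽ʷ⁾)(1) ≥ 2d · (Tᵗ m⁽ʷ⁾)(0) = 2d · d⁽ʷ⁾ Zₜ(w),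
    -- and d⁽ʷ⁾ > 0 may be cancelled.
    walkCount-doubling : ∀ {w} → 1 ≤ d → d ≤ 2 * w → w ≤ d → ∀ t → 2 * d * walkCount t w ≤ walkCount (suc t) w
    walkCount-doubling {w} 1≤d d≤2w w≤d t = *-cancelˡ-≤ F {{>-nonZero (falling-pos w≤d)}} (begin
      F * (2 * d * walkCount t w)       ≡⟨ solve 3 (λ F d Z → F :* (con 2 :* d :* Z) := d :* (con 2 :* (F :* Z))) refl F d (walkCount t w) ⟩
      d * (2 * (F * walkCount t w))     ≡⟨ cong (λ x → d * (2 * x)) (walked-at-0 t w) ⟨
      d * (2 * walked t w 0)            ≤⟨ *-monoʳ-≤ d (walked-doubling w d≤2w t 0 1≤d) ⟩
      d * walked t w 1                  ≡⟨ walked-at-0 (suc t) w ⟩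
      F * walkCount (suc t) w           ∎)
      where
      open ≤-Reasoning
      F = falling w d

module NaturalEmbedding where

  open import Data.Nat as ℕ using (ℕ; zero; suc)
  import Data.Nat.Properties as ℕ
  import Data.Integer as ℤ
  open import Data.Integer.Tactic.RingSolver using (solve-∀)
  open import Data.Rational using (ℚ; 0ℚ; 1ℚ; _/_; _+_; _*_; _≤_; toℚᵘ; Positive; NonNegative)
  open import Data.Rational.Properties
  import Data.Rational.Unnormalised as ℚᵘ
  import Data.Rational.Unnormalised.Properties as ℚᵘ
  open import Algebra.Bundles using (Ring)
  open import Algebra.Properties.Semiring.Mult (Ring.semiring +-*-ring) using (_×_; ×-homo-+; ×1-homo-*)
  open import Data.Product using (_,_)
  open import Relation.Binary.PropositionalEquality

  ι : ℕ → ℚ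
  ι n = n × 1ℚ

  ι-+ : ∀ m n → ι (m ℕ.+ n) ≡ ι m + ι n
  ι-+ = ×-homo-+ 1ℚ

  ι-* : ∀ m n → ι (m ℕ.* n) ≡ ι m * ι n
  ι-* = ×1-homo-*

  ι-nonNeg : ∀ n → NonNegative (ι n)
  ι-nonNeg zero = _
  ι-nonNeg (suc n) = nonNeg+nonNeg⇒nonNeg 1ℚ (ι n) {{ι-nonNeg n}}

  ι-pos : ∀ {n} → 0 ℕ.< n → Positive (ι n)
  ι-pos {suc n} _ = pos+nonNeg⇒pos 1ℚ (ι n) {{ι-nonNeg n}}

  ι-mono : ∀ {m n} → m ℕ.≤ n → ι m ≤ ι n
  ι-mono {m} m≤n with ℕ.m≤n⇒∃[o]m+o≡n m≤n
  ... | k , refl = begin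
    ι m          ≡⟨ +-identityʳ (ι m) ⟨
    ι m + 0ℚ     ≤⟨ +-monoʳ-≤ (ι m) (nonNegative⁻¹ (ι k) {{ι-nonNeg k}}) ⟩
    ι m + ι k    ≡⟨ ι-+ m k ⟨
    ι (m ℕ.+ k)  ∎
    where open ≤-Reasoning

  ι-unnormalised : ∀ n → toℚᵘ (ι n) ℚᵘ.≃ ℚᵘ.mkℚᵘ (ℤ.+ n) 0
  ι-unnormalised zero = ℚᵘ.≃-refl
  ι-unnormalised (suc n) = ℚᵘ.≃-trans (toℚᵘ-homo-+ 1ℚ (ι n))
    (ℚᵘ.≃-trans (ℚᵘ.+-congʳ (toℚᵘ 1ℚ) (ι-unnormalised n)) (ℚᵘ.*≡* (cross (ℤ.+ n))))
    where
    cross : ∀ m → (ℤ.1ℤ ℤ.* ℤ.1ℤ ℤ.+ m ℤ.* ℤ.1ℤ) ℤ.* ℤ.1ℤ ≡ (ℤ.1ℤ ℤ.+ m) ℤ.* (ℤ.1ℤ ℤ.* ℤ.1ℤ)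
    cross = solve-∀

  ι-inverse : ∀ n → (ℤ.+ 1 / suc n) * ι (suc n) ≡ 1ℚ
  ι-inverse n = toℚᵘ-injective (ℚᵘ.≃-trans (toℚᵘ-homo-* (ℤ.+ 1 / suc n) (ι (suc n)))
    (ℚᵘ.≃-trans (ℚᵘ.*-cong (toℚᵘ-fromℚᵘ (ℚᵘ.mkℚᵘ (ℤ.+ 1) n)) (ι-unnormalised (suc n)))
      (ℚᵘ.*≡* (cross (ℤ.+ n)))))
    where
    cross : ∀ m → (ℤ.1ℤ ℤ.* (ℤ.1ℤ ℤ.+ m)) ℤ.* ℤ.1ℤ ≡ ℤ.1ℤ ℤ.* ((ℤ.1ℤ ℤ.+ m) ℤ.* ℤ.1ℤ)
    cross = solve-∀

module RadialProfile where

  open import Defs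
  open NaturalEmbedding
  open import Data.Bool using (true; false)
  open import Data.Nat as ℕ using (ℕ; zero; suc)
  import Data.Nat.Properties as ℕ
  import Data.Integer as ℤ
  open import Data.Rational using (ℚ; 0ℚ; 1ℚ; _/_; _+_; _*_; _≤_)
  open import Data.Rational.Properties
  open import Data.Rational.Solver using (module +-*-Solver)
  open +-*-Solver
  open import Data.Vec using (_∷_; [])
  open import Data.List using ([]; _∷_; map; _++_)
  import Data.List.Properties as List
  open import Function using (_∘_)
  open import Relation.Binary.PropositionalEquality

  sumℚ-++ : ∀ xs ys → sumℚ (xs ++ ys) ≡ sumℚ xs + sumℚ ys
  sumℚ-++ [] ys = sym (+-identityˡ (sumℚ ys))
  sumℚ-++ (x ∷ xs) ys = trans (cong (x +_) (sumℚ-++ xs ys)) (sym (+-assoc x (sumℚ xs) (sumℚ ys)))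

  -- Summing over the (d+1)-cube splits according to the first coordinate; each case
  -- of the sums below is computed by evaluating the two halves and merging them.
  sum-cube-split : ∀ {d} (f : Vertex (suc d) → ℚ) {u v r} →
    sumℚ (map (f ∘ (true ∷_)) (allVertices d)) ≡ u →
    sumℚ (map (f ∘ (false ∷_)) (allVertices d)) ≡ v →
    u + v ≡ r → sumℚ (map f (allVertices (suc d))) ≡ r
  sum-cube-split {d} f refl refl refl = begin
    sumℚ (map f (ts ++ fs))                 ≡⟨ cong sumℚ (List.map-++ f ts fs) ⟩
    sumℚ (map f ts ++ map f fs)             ≡⟨ sumℚ-++ (map f ts) (map f fs) ⟩
    sumℚ (map f ts) + sumℚ (map f fs)       ≡⟨ cong₂ (λ x y → sumℚ x + sumℚ y) (List.map-∘ (allVertices d)) (List.map-∘ (allVertices d)) ⟨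
    sumℚ (map (f ∘ (true ∷_)) (allVertices d)) + sumℚ (map (f ∘ (false ∷_)) (allVertices d)) ∎
    where
    open ≡-Reasoning
    ts = map (true ∷_) (allVertices d)
    fs = map (false ∷_) (allVertices d)

  nearKernel : ℚ → ℚ → ℕ → ℚ
  nearKernel a b zero = a
  nearKernel a b (suc zero) = b
  nearKernel a b (suc (suc _)) = 0ℚ

  nearKernel-shift : ∀ a b n → nearKernel a b (suc n) ≡ nearKernel b 0ℚ n
  nearKernel-shift a b zero = refl
  nearKernel-shift a b (suc zero) = refl
  nearKernel-shift a b (suc (suc n)) = refl

  -- kernelSum = Σₖ H(dist x k)·K(dist k y): a radial function around x against the
  -- kernel K = nearKernel a b around y; (Pᵗ⁺¹)ᵢⱼ has this form.
  summand : ∀ {d} → (ℕ → ℚ) → ℚ → ℚ → Vertex d → Vertex d → Vertex d → ℚ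
  summand H a b x y k = H (dist x k) * nearKernel a b (dist k y)

  kernelSum : ∀ {d} → (ℕ → ℚ) → ℚ → ℚ → Vertex d → Vertex d → ℚ
  kernelSum {d} H a b x y = sumℚ (map (summand H a b x y) (allVertices d))

  -- Its value when dist x y = w: y contributes H(w)·a, and y has w neighbours at
  -- distance w - 1 and d - w neighbours at distance w + 1 from x.
  radialStep : ℕ → (ℕ → ℚ) → ℚ → ℚ → ℕ → ℚ
  radialStep d H a b w = H w * a + (ι w * H (w ℕ.∸ 1) + ι (d ℕ.∸ w) * H (suc w)) * b

  dist-≤ : ∀ {d} (x y : Vertex d) → dist x y ℕ.≤ d
  dist-≤ [] [] = ℕ.z≤n
  dist-≤ (true ∷ x) (true ∷ y) = ℕ.m≤n⇒m≤1+n (dist-≤ x y)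
  dist-≤ (false ∷ x) (false ∷ y) = ℕ.m≤n⇒m≤1+n (dist-≤ x y)
  dist-≤ (true ∷ x) (false ∷ y) = ℕ.s≤s (dist-≤ x y)
  dist-≤ (false ∷ x) (true ∷ y) = ℕ.s≤s (dist-≤ x y)

  -- Adding a coordinate on which x and y agree: the new neighbour of y lies one step further from x.
  radialStep-agree : ∀ d H a b w → w ℕ.≤ d →
    radialStep d H a b w + radialStep d (H ∘ suc) b 0ℚ w ≡ radialStep (suc d) H a b w
  radialStep-agree d H a b w w≤d rewrite ℕ.+-∸-assoc 1 w≤d =
    solve 9 (λ Hw a cw Hm cdw Hp b Hsm Hpp →
       Hw :* a :+ (cw :* Hm :+ cdw :* Hp) :* b :+ (Hp :* b :+ (cw :* Hsm :+ cdw :* Hpp) :* con 0ℚ)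
       := Hw :* a :+ (cw :* Hm :+ (con 1ℚ :+ cdw) :* Hp) :* b) refl
       (H w) a (ι w) (H (w ℕ.∸ 1)) (ι (d ℕ.∸ w)) (H (suc w)) b (H (suc (w ℕ.∸ 1))) (H (suc (suc w)))

  -- ι w · H(w - 1 + 1) = ι w · H(w): for w = 0 both vanish.
  ι-pred-suc : ∀ (H : ℕ → ℚ) w → ι w * H (suc (w ℕ.∸ 1)) ≡ ι w * H w
  ι-pred-suc H zero = trans (*-zeroˡ (H 1)) (sym (*-zeroˡ (H 0)))
  ι-pred-suc H (suc w) = refl

  -- Adding a coordinate on which x and y differ: the new neighbour of y lies one step closer to x.
  radialStep-differ : ∀ d H a b w →
    radialStep d H b 0ℚ w + radialStep d (H ∘ suc) a b w ≡ radialStep (suc d) H a b (suc w)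
  radialStep-differ d H a b w rewrite ι-pred-suc H w =
    solve 8 (λ Hw a cw Hm cdw Hp b Hpp →
       Hw :* b :+ (cw :* Hm :+ cdw :* Hp) :* con 0ℚ :+ (Hp :* a :+ (cw :* Hw :+ cdw :* Hpp) :* b)
       := Hp :* a :+ ((con 1ℚ :+ cw) :* Hw :+ cdw :* Hpp) :* b) refl
       (H w) a (ι w) (H (w ℕ.∸ 1)) (ι (d ℕ.∸ w)) (H (suc w)) b (H (suc (suc w)))

  kernelSum-radial-far : ∀ {d} (x y : Vertex d) H a b →
    sumℚ (map (λ k → H (dist x k) * nearKernel a b (suc (dist k y))) (allVertices d)) ≡ radialStep d H b 0ℚ (dist x y)

  kernelSum-radial : ∀ {d} (x y : Vertex d) H a b → kernelSum H a b x y ≡ radialStep d H a b (dist x y)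
  kernelSum-radial [] [] H a b =
    solve 4 (λ h₀ a b h₁ → h₀ :* a :+ con 0ℚ := h₀ :* a :+ (con 0ℚ :* h₀ :+ con 0ℚ :* h₁) :* b) refl (H 0) a b (H 1)
  kernelSum-radial (true ∷ x) (true ∷ y) H a b = sum-cube-split (summand H a b (true ∷ x) (true ∷ y))
    (kernelSum-radial x y H a b) (kernelSum-radial-far x y (H ∘ suc) a b) (radialStep-agree _ H a b _ (dist-≤ x y))
  kernelSum-radial {suc d} (false ∷ x) (false ∷ y) H a b = sum-cube-split (summand H a b (false ∷ x) (false ∷ y))
    (kernelSum-radial-far x y (H ∘ suc) a b) (kernelSum-radial x y H a b)
    (trans (+-comm (radialStep d (H ∘ suc) b 0ℚ (dist x y)) _) (radialStep-agree d H a b _ (dist-≤ x y)))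
  kernelSum-radial (true ∷ x) (false ∷ y) H a b = sum-cube-split (summand H a b (true ∷ x) (false ∷ y))
    (kernelSum-radial-far x y H a b) (kernelSum-radial x y (H ∘ suc) a b) (radialStep-differ _ H a b _)
  kernelSum-radial {suc d} (false ∷ x) (true ∷ y) H a b = sum-cube-split (summand H a b (false ∷ x) (true ∷ y))
    (kernelSum-radial x y (H ∘ suc) a b) (kernelSum-radial-far x y H a b)
    (trans (+-comm (radialStep d (H ∘ suc) a b (dist x y)) _) (radialStep-differ d H a b _))

  kernelSum-radial-far {d} x y H a b = trans
    (cong sumℚ (List.map-cong (λ k → cong (H (dist x k) *_) (nearKernel-shift a b (dist k y))) (allVertices d)))
    (kernelSum-radial x y H b 0ℚ)

  ½ : ℚ
  ½ = ℤ.+ 1 / 2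

  -- The radial profile of Pᵗ, defined by the recurrence that kernelSum-radial produces.
  profile : ℕ → ℕ → ℕ → ℚ
  profile d zero zero = 1ℚ
  profile d zero (suc _) = 0ℚ
  profile d (suc t) w = radialStep d (profile d t) ½ (inv2d d) w

  P-radial : ∀ d (k j : Vertex d) → P d k j ≡ nearKernel ½ (inv2d d) (dist k j)
  P-radial d k j with dist k j
  ... | zero = refl
  ... | suc zero = refl
  ... | suc (suc _) = refl

  Ppow-profile : ∀ d t (i j : Vertex d) → Ppow d t i j ≡ profile d t (dist i j)
  Ppow-profile d zero i j with dist i j
  ... | zero = refl
  ... | suc _ = refl
  Ppow-profile d (suc t) i j = trans
    (cong sumℚ (List.map-cong (λ k → cong₂ _*_ (Ppow-profile d t i k) (P-radial d k j)) (allVertices d)))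
    (kernelSum-radial i j (profile d t) ½ (inv2d d))

  radialStep-cong : ∀ d {H G} a b w → (∀ n → H n ≡ G n) → radialStep d H a b w ≡ radialStep d G a b w
  radialStep-cong d a b w H≡G = cong₂ (λ x y → x * a + y * b)
    (H≡G w) (cong₂ (λ x y → ι w * x + ι (d ℕ.∸ w) * y) (H≡G (w ℕ.∸ 1)) (H≡G (suc w)))

  radialStep-scale : ∀ d H a b w c k → radialStep d H a b w * (c * k) ≡ radialStep d (λ n → H n * k) (a * c) (b * c) w
  radialStep-scale d H a b w c k =
    solve 9 (λ h a ι₁ h₋ ι₂ h₊ b c k →
        (h :* a :+ (ι₁ :* h₋ :+ ι₂ :* h₊) :* b) :* (c :* k)
     := h :* k :* (a :* c) :+ (ι₁ :* (h₋ :* k) :+ ι₂ :* (h₊ :* k)) :* (b :* c)) refl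
     (H w) a (ι w) (H (w ℕ.∸ 1)) (ι (d ℕ.∸ w)) (H (suc w)) b c k

  step⇒monotone : ∀ (f : ℕ → ℚ) → (∀ t → f t ≤ f (suc t)) → ∀ {s t} → s ℕ.≤ t → f s ≤ f t
  step⇒monotone f step s≤t = go (ℕ.≤⇒≤′ s≤t)
    where
    go : ∀ {s t} → s ℕ.≤′ t → f s ≤ f t
    go ℕ.≤′-refl = ≤-refl
    go (ℕ.≤′-step s≤′t) = ≤-trans (go s≤′t) (step _)

  module Scaling (n : ℕ) where
    open FallingFactorialWalk.Walk (suc n) using (walkCount; walkCount-doubling)

    d : ℕ
    d = suc n

    -- Multiplied by 2d, the weights ½ and 1/2d of P become d and 1.
    ½-scaled : ½ * ι (2 ℕ.* d) ≡ ι d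
    ½-scaled = begin
      ½ * ι (2 ℕ.* d)          ≡⟨ cong (½ *_) (ι-* 2 d) ⟩
      ½ * (ι 2 * ι d)          ≡⟨ *-assoc ½ (ι 2) (ι d) ⟨
      (½ * ι 2) * ι d          ≡⟨ cong (_* ι d) (ι-inverse 1) ⟩
      1ℚ * ι d                 ≡⟨ *-identityˡ (ι d) ⟩
      ι d                      ∎
      where open ≡-Reasoning

    inv2d-scaled : inv2d d * ι (2 ℕ.* d) ≡ 1ℚ
    inv2d-scaled = ι-inverse (n ℕ.+ 1 ℕ.* d)

    ι-walkCount-step : ∀ t w → ι (walkCount (suc t) w) ≡ radialStep d (ι ∘ walkCount t) (ι d) 1ℚ w
    ι-walkCount-step t w = begin
      ι (d ℕ.* Z₀ ℕ.+ w ℕ.* Z₋ ℕ.+ (d ℕ.∸ w) ℕ.* Z₊)            ≡⟨ ι-+ (d ℕ.* Z₀ ℕ.+ w ℕ.* Z₋) _ ⟩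
      ι (d ℕ.* Z₀ ℕ.+ w ℕ.* Z₋) + ι ((d ℕ.∸ w) ℕ.* Z₊)         ≡⟨ cong₂ _+_ (ι-+ (d ℕ.* Z₀) _) (ι-* (d ℕ.∸ w) Z₊) ⟩
      ι (d ℕ.* Z₀) + ι (w ℕ.* Z₋) + ι (d ℕ.∸ w) * ι Z₊         ≡⟨ cong₂ (λ x y → x + y + ι (d ℕ.∸ w) * ι Z₊) (ι-* d Z₀) (ι-* w Z₋) ⟩
      ι d * ι Z₀ + ι w * ι Z₋ + ι (d ℕ.∸ w) * ι Z₊             ≡⟨ solve 6 (λ ιd z₀ ιw z₋ ιdw z₊ → ιd :* z₀ :+ ιw :* z₋ :+ ιdw :* z₊ := z₀ :* ιd :+ (ιw :* z₋ :+ ιdw :* z₊) :* con 1ℚ) refl (ι d) (ι Z₀) (ι w) (ι Z₋) (ι (d ℕ.∸ w)) (ι Z₊) ⟩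
      radialStep d (ι ∘ walkCount t) (ι d) 1ℚ w                 ∎
      where
      open ≡-Reasoning
      Z₀ = walkCount t w
      Z₋ = walkCount t (w ℕ.∸ 1)
      Z₊ = walkCount t (suc w)

    profile-scaled : ∀ t w → profile d t w * ι ((2 ℕ.* d) ℕ.^ t) ≡ ι (walkCount t w)
    profile-scaled zero zero = *-identityˡ 1ℚ
    profile-scaled zero (suc w) = *-zeroˡ 1ℚ
    profile-scaled (suc t) w = begin
      radialStep d (profile d t) ½ (inv2d d) w * ι (2 ℕ.* d ℕ.* K)                            ≡⟨ cong (radialStep d (profile d t) ½ (inv2d d) w *_) (ι-* (2 ℕ.* d) K) ⟩
      radialStep d (profile d t) ½ (inv2d d) w * (ι (2 ℕ.* d) * ι K)                          ≡⟨ radialStep-scale d (profile d t) ½ (inv2d d) w (ι (2 ℕ.* d)) (ι K) ⟩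
      radialStep d (λ m → profile d t m * ι K) (½ * ι (2 ℕ.* d)) (inv2d d * ι (2 ℕ.* d)) w  ≡⟨ cong₂ (λ x y → radialStep d (λ m → profile d t m * ι K) x y w) ½-scaled inv2d-scaled ⟩
      radialStep d (λ m → profile d t m * ι K) (ι d) 1ℚ w                                     ≡⟨ radialStep-cong d (ι d) 1ℚ w (profile-scaled t) ⟩
      radialStep d (ι ∘ walkCount t) (ι d) 1ℚ w                                               ≡⟨ ι-walkCount-step t w ⟨
      ι (walkCount (suc t) w)                                                                 ∎
      where
      open ≡-Reasoning
      K = (2 ℕ.* d) ℕ.^ t

    profile-step : ∀ {w} → d ℕ.≤ 2 ℕ.* w → w ℕ.≤ d → ∀ t → profile d t w ≤ profile d (suc t) w
    profile-step {w} d≤2w w≤d t = *-cancelʳ-≤-pos (ι (2 ℕ.* d ℕ.* K)) {{ι-pos (ℕ.m^n>0 (2 ℕ.* d) (suc t))}} (begin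
      profile d t w * ι (2 ℕ.* d ℕ.* K)          ≡⟨ cong (profile d t w *_) (trans (ι-* (2 ℕ.* d) K) (*-comm (ι (2 ℕ.* d)) (ι K))) ⟩
      profile d t w * (ι K * ι (2 ℕ.* d))        ≡⟨ *-assoc (profile d t w) (ι K) (ι (2 ℕ.* d)) ⟨
      profile d t w * ι K * ι (2 ℕ.* d)          ≡⟨ cong (_* ι (2 ℕ.* d)) (profile-scaled t w) ⟩
      ι (walkCount t w) * ι (2 ℕ.* d)            ≡⟨ trans (ι-* (2 ℕ.* d) (walkCount t w)) (*-comm (ι (2 ℕ.* d)) (ι (walkCount t w))) ⟨
      ι (2 ℕ.* d ℕ.* walkCount t w)              ≤⟨ ι-mono (walkCount-doubling (ℕ.s≤s ℕ.z≤n) d≤2w w≤d t) ⟩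
      ι (walkCount (suc t) w)                    ≡⟨ profile-scaled (suc t) w ⟨
      profile d (suc t) w * ι (2 ℕ.* d ℕ.* K)    ∎)
      where
      open ≤-Reasoning
      K = (2 ℕ.* d) ℕ.^ t

open import Defs
open import Data.Nat using (ℕ; _≤_; _*_; suc)
open import Data.Rational using () renaming (_≤_ to _≤ℚ_)
open import Relation.Binary.PropositionalEquality using (subst₂; sym)
open RadialProfile

mainTheorem7 : (d : ℕ) → 1 ≤ d → (i j : Vertex d) → d ≤ 2 * dist i j →
    (s t : ℕ) → s ≤ t → Ppow d s i j ≤ℚ Ppow d t i j
mainTheorem7 (suc n) _ i j d≤2w s t s≤t =
  subst₂ _≤ℚ_ (sym (Ppow-profile (suc n) s i j)) (sym (Ppow-profile (suc n) t i j))
    (step⇒monotone (λ t → profile (suc n) t (dist i j)) (Scaling.profile-step n d≤2w (dist-≤ i j)) s≤t)
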